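{- Let an instance of \textsc{L-Sided Pricing} be given, let $p^*$ be an optimal pricing, and let $p$ be a pricing that is locally optimal, i.e. $\mathrm{val}(p')\le\mathrm{val}(p)$ for every pricing $p'$ with $\mathrm{HW}(p,p')=1$. Then $\mathrm{val}(p)\ge\mathrm{val}(p^*)/2$.
   Context: An instance of \textsc{L-Sided Pricing} consists of a finite bipartite graph $G=(L\cup R,E)$ (parallel edges allowed, no loops; each edge joins $L$ and $R$), a capacity $\mu_w\in\mathbb Z_{\ge 0}\cup\{\infty\}$ for every vertex $w$, and a budget $b_e\ge 0$ for every edge $e$. For $u\in L$ let $P_u=\{b_e: e\in E\text{ incident to }u\}$. A pricing is a function $p$ on $L$ with $p(u)\in P_u$ for every $u\in L$, extended by $p(v)=0$ for $v\in R$. For a pricing $p$, $\mathrm{val}(p)$ is the maximum of $\sum_{e=uv\in F}(p(u)+p(v))$ over all $F\subseteq E$ such that $p(u)+p(v)\le b_e$ for every $e=uv\in F$ and every vertex $w$ is incident to at most $\mu_w$ edges of $F$. An optimal pricing is a pricing maximizing $\mathrm{val}$. For pricings $p,p'$, $\mathrm{HW}(p,p')=|\{u\in L: p(u)\ne p'(u)\}|$.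
   Formalization: The edge budgets $b_e$ are nonnegative rationals, so pricings take rational values. -}

module Defs where

open import Data.Nat using (ℕ)
import Data.Nat as ℕ
open import Data.Fin using (Fin)
open import Data.Bool using (Bool; true; false; T; _∧_)
open import Data.Maybe using (Maybe; just; nothing)
open import Data.Unit using (⊤)
open import Data.Sum using (_⊎_; inj₁; inj₂)
open import Data.Product using (_×_; Σ; ∃)
open import Data.List using (List; length; filter; foldr; map)
open import Data.List.Base using (allFin)
open import Data.Rational using (ℚ; _+_; _≤_; 0ℚ)
open import Data.Rational.Properties using (_≟_)
open import Relation.Nullary using (¬?; ⌊_⌋)
open import Relation.Binary.PropositionalEquality using (_≡_)
open import Data.Fin.Properties using () renaming (_≟_ to _≟F_)

-- Capacities in ℤ≥0 ∪ {∞}: 'nothing' encodes ∞.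
Cap : Set
Cap = Maybe ℕ

_≤cap_ : ℕ → Cap → Set
n ≤cap nothing = ⊤
n ≤cap just k  = n ℕ.≤ k

-- An instance of L-Sided Pricing: L = Fin nL, R = Fin nR, edges indexed by Fin m
-- (parallel edges allowed), each edge e joins left e ∈ L and right e ∈ R.
record Instance : Set where
  field
    nL nR m : ℕ
    left    : Fin m → Fin nL
    right   : Fin m → Fin nR
    μL      : Fin nL → Cap
    μR      : Fin nR → Cap
    budget  : Fin m → ℚ
    budget≥0 : ∀ e → 0ℚ ≤ budget e

module _ (I : Instance) where
  open Instance I

  Vertex : Set
  Vertex = Fin nL ⊎ Fin nR

  μ : Vertex → Cap
  μ (inj₁ u) = μL u
  μ (inj₂ v) = μR v

  endL endR : Fin m → Vertex
  endL e = inj₁ (left e)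
  endR e = inj₂ (right e)

  IsPricing : (Fin nL → ℚ) → Set
  IsPricing p = ∀ u → Σ (Fin m) λ e → (left e ≡ u) × (p u ≡ budget e)

  ext : (Fin nL → ℚ) → Vertex → ℚ
  ext p (inj₁ u) = p u
  ext p (inj₂ v) = 0ℚ

  _≟V_ : (x y : Vertex) → Relation.Nullary.Dec (x ≡ y)
  inj₁ a ≟V inj₁ b with a ≟F b
  ... | Relation.Nullary.yes Relation.Binary.PropositionalEquality.refl = Relation.Nullary.yes Relation.Binary.PropositionalEquality.refl
  ... | Relation.Nullary.no ne = Relation.Nullary.no λ { Relation.Binary.PropositionalEquality.refl → ne Relation.Binary.PropositionalEquality.refl }
  inj₁ a ≟V inj₂ b = Relation.Nullary.no λ ()
  inj₂ a ≟V inj₁ b = Relation.Nullary.no λ ()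
  inj₂ a ≟V inj₂ b with a ≟F b
  ... | Relation.Nullary.yes Relation.Binary.PropositionalEquality.refl = Relation.Nullary.yes Relation.Binary.PropositionalEquality.refl
  ... | Relation.Nullary.no ne = Relation.Nullary.no λ { Relation.Binary.PropositionalEquality.refl → ne Relation.Binary.PropositionalEquality.refl }

  incident : Fin m → Vertex → Bool
  incident e w = ⌊ endL e ≟V w ⌋ Data.Bool.∨ ⌊ endR e ≟V w ⌋

  degF : (Fin m → Bool) → Vertex → ℕ
  degF F w = length (filter (λ e → T? (F e ∧ incident e w)) (allFin m))
    where
      open import Relation.Nullary.Decidable using () renaming (T? to T?)

  Feasible : (Fin nL → ℚ) → (Fin m → Bool) → Set
  Feasible p F =
    (∀ e → T (F e) → ext p (endL e) + ext p (endR e) ≤ budget e) ×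
    (∀ w → degF F w ≤cap μ w)

  revenue : (Fin nL → ℚ) → (Fin m → Bool) → ℚ
  revenue p F = foldr _+_ 0ℚ
    (map (λ e → ext p (endL e) + ext p (endR e))
         (filter (λ e → T? (F e)) (allFin m)))
    where
      open import Relation.Nullary.Decidable using () renaming (T? to T?)

  IsVal : (Fin nL → ℚ) → ℚ → Set
  IsVal p v =
    (∃ λ F → Feasible p F × revenue p F ≡ v) ×
    (∀ F → Feasible p F → revenue p F ≤ v)

  HW : (Fin nL → ℚ) → (Fin nL → ℚ) → ℕ
  HW p p' = length (filter (λ u → ¬? (p u ≟ p' u)) (allFin nL))

-- Let Fs and Fp be revenue-maximising edge sets for p* and p. At every right vertex pair
-- the i-th Fp-edge with the i-th Fs-edge. For u ∈ L, the deviation p_u is p with the price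
-- of u set to p*(u), and the exchanged set F_u consists of the Fs-edges at u together with
-- the Fp-edges elsewhere whose partner is not an Fs-edge at u (the others are displaced by u).
-- The pairing keeps F_u within all capacities, and p_u differs from p only at u, so local
-- optimality gives revenue(p_u, F_u) ≤ val(p): the Fs-revenue at u is at most the Fp-revenue
-- at u plus the revenue of the Fp-edges displaced by u. Each Fp-edge is displaced by at most
-- one u, so summing over u yields val(p*) ≤ 2 val(p).

module Submission where

open import Defs
open import Data.Fin using (Fin)
open import Data.Rational using (ℚ; _≤_; _*_; ½)
open import Relation.Binary.PropositionalEquality using (_≡_)

open import Data.Bool using (Bool; true; false; T; not; _∧_; _∨_; if_then_else_)
open import Data.Bool.Properties using (T-∧; T-∨)
open import Data.Empty using (⊥-elim)
open import Data.Fin using (zero; suc)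
open import Data.Fin.Properties using (_≟_; all?)
open import Data.List using (List; []; _∷_; [_]; length; filter; filterᵇ; foldr; map; _++_; allFin; tabulate)
import Data.Rational.Properties as QP
open import Relation.Binary.Bundles using (DecTotalOrder)
open import Data.List.Extrema (DecTotalOrder.totalOrder QP.≤-decTotalOrder)
  using (argmax; argmax-all; f[xs]≤f[argmax])
open import Data.List.Membership.Propositional using (_∈_)
open import Data.List.Membership.Propositional.Properties using (∈-allFin; ∈-filter⁺; ∈-filter⁻; ∈-++⁺ˡ; ∈-++⁺ʳ; ∈-map⁺)
open import Data.List.Properties using (filter-accept; filter-reject; filter-none)
import Data.List.Relation.Unary.All as All
open import Data.List.Relation.Unary.AllPairs using (_∷_)
open import Data.List.Relation.Unary.All.Properties using (all-filter)
open import Data.List.Relation.Unary.Any using (here; there)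
open import Data.List.Relation.Unary.Unique.Propositional using (Unique)
open import Data.List.Relation.Unary.Unique.Propositional.Properties using (allFin⁺) renaming (filter⁺ to Unique-filter⁺)
open import Data.Maybe using (Maybe; just; nothing; maybe)
open import Data.Nat as ℕ using (ℕ; z≤n; s≤s; _⊔_)
import Data.Nat.Properties as ℕP
open import Data.Product using (_×_; _,_; proj₁; proj₂; Σ; ∃)
open import Data.Rational using (0ℚ; _+_; -_)
open import Data.Sum using (_⊎_; inj₁; inj₂; [_,_])
open import Data.Sum.Properties using (inj₁-injective; inj₂-injective)
open import Data.Unit using (tt)
import Data.Vec.Functional as Vector
open import Function using (_∘_; id; Equivalence)
open import Relation.Binary.PropositionalEquality using (refl; sym; trans; cong; cong₂; subst; _≗_; _≢_; module ≡-Reasoning)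
open import Relation.Nullary using (Dec; does; yes; no; ⌊_⌋)
open import Relation.Nullary.Decidable using (dec-true; dec-false; map′; _×-dec_; _→-dec_; T?; ¬?; toWitness)
open import Relation.Unary using (Decidable)

open import Algebra.Properties.CommutativeMonoid.Sum QP.+-0-commutativeMonoid
  using (sum-syntax; ∑-comm; ∑-distrib-+; sum-cong-≗; sum-replicate-zero)

private variable
  A B : Set
  n : ℕ

count : (A → Bool) → List A → ℕ
count P []       = 0
count P (x ∷ xs) = if P x then ℕ.suc (count P xs) else count P xs

length-filterᵇ : (P : A → Bool) (xs : List A) → length (filterᵇ P xs) ≡ count P xs
length-filterᵇ P []       = refl
length-filterᵇ P (x ∷ xs) with P x
... | true  = cong ℕ.suc (length-filterᵇ P xs)
... | false = length-filterᵇ P xs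

count-filterᵇ : (P Q : A → Bool) (xs : List A) → count P (filterᵇ Q xs) ≡ count (λ x → Q x ∧ P x) xs
count-filterᵇ P Q []       = refl
count-filterᵇ P Q (x ∷ xs) with Q x
... | false = count-filterᵇ P Q xs
... | true with P x
...   | true  = cong ℕ.suc (count-filterᵇ P Q xs)
...   | false = count-filterᵇ P Q xs

count-cong : (P Q : A → Bool) (xs : List A) → (∀ {x} → x ∈ xs → P x ≡ Q x) → count P xs ≡ count Q xs
count-cong P Q []       _   = refl
count-cong P Q (x ∷ xs) P≡Q rewrite P≡Q (here refl) | count-cong P Q xs (P≡Q ∘ there) = refl

count-mono : {P Q : A → Bool} → (∀ x → T (P x) → T (Q x)) → (xs : List A) → count P xs ℕ.≤ count Q xs
count-mono P⇒Q [] = z≤n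
count-mono {P = P} {Q} P⇒Q (x ∷ xs) with P x in Px | Q x in Qx
... | true  | true  = s≤s (count-mono P⇒Q xs)
... | true  | false = ⊥-elim (subst T Qx (P⇒Q x (subst T (sym Px) tt)))
... | false | true  = ℕP.m≤n⇒m≤1+n (count-mono P⇒Q xs)
... | false | false = count-mono P⇒Q xs

count-∨ : (P Q : A → Bool) (xs : List A) → count (λ x → P x ∨ Q x) xs ℕ.≤ count P xs ℕ.+ count Q xs
count-∨ P Q []       = z≤n
count-∨ P Q (x ∷ xs) with P x | Q x
... | true  | true  = s≤s (ℕP.≤-trans (count-∨ P Q xs) (ℕP.+-monoʳ-≤ (count P xs) (ℕP.n≤1+n _)))
... | true  | false = s≤s (count-∨ P Q xs)
... | false | true  = ℕP.≤-trans (s≤s (count-∨ P Q xs)) (ℕP.≤-reflexive (sym (ℕP.+-suc _ _)))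
... | false | false = count-∨ P Q xs

count≤length : (P : A → Bool) (xs : List A) → count P xs ℕ.≤ length xs
count≤length P []       = z≤n
count≤length P (x ∷ xs) with P x
... | true  = s≤s (count≤length P xs)
... | false = ℕP.m≤n⇒m≤1+n (count≤length P xs)

count-true : (xs : List A) → count (λ _ → true) xs ≡ length xs
count-true []       = refl
count-true (x ∷ xs) = cong ℕ.suc (count-true xs)

length-filter-unique : {P : A → Set} (P? : Decidable P) {c : A} {xs : List A} → Unique xs → c ∈ xs →
  P c → (∀ {x} → P x → x ≡ c) → length (filter P? xs) ≡ 1
length-filter-unique P? {xs = _ ∷ xs} (c∉xs ∷ _) (here refl) Pc only rewrite filter-accept P? {xs = xs} Pc =
  cong (ℕ.suc ∘ length) (filter-none P? (All.map (λ c≢x Px → c≢x (sym (only Px))) c∉xs))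
length-filter-unique P? {xs = x ∷ xs} (x∉xs ∷ unique) (there c∈xs) Pc only
  rewrite filter-reject P? {xs = xs} (λ Px → All.lookup x∉xs c∈xs (only Px)) =
  length-filter-unique P? unique c∈xs Pc only

module _ (_≟ᴬ_ : (x y : A) → Dec (x ≡ y)) where

  partnerIn : A → List A → List B → Maybe B
  partnerIn x (x′ ∷ xs) (y ∷ ys) = if does (x ≟ᴬ x′) then just y else partnerIn x xs ys
  partnerIn x _         _        = nothing

  count-unpartnered : (P : B → Bool) (xs : List A) (ys : List B) → Unique xs →
    count (λ x → not (maybe P false (partnerIn x xs ys))) xs ℕ.+ count P ys ℕ.≤ length xs ⊔ length ys
  count-unpartnered P []       ys _ = count≤length P ys
  count-unpartnered P (x ∷ xs) [] _ = ℕP.≤-reflexive (trans (ℕP.+-identityʳ _) (count-true (x ∷ xs)))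
  count-unpartnered P (x ∷ xs) (y ∷ ys) (x∉xs ∷ unique)
    rewrite dec-true (x ≟ᴬ x) refl
          | count-cong (λ z → not (maybe P false (partnerIn z (x ∷ xs) (y ∷ ys))))
                       (λ z → not (maybe P false (partnerIn z xs ys))) xs
                       (λ {z} z∈xs → cong (λ b → not (maybe P false (if b then just y else partnerIn z xs ys)))
                                      (dec-false (_ ≟ᴬ x) (All.lookup x∉xs z∈xs ∘ sym)))
    with P y | count-unpartnered P xs ys unique
  ... | true  | ih = ℕP.≤-trans (ℕP.≤-reflexive (ℕP.+-suc _ _)) (s≤s ih)
  ... | false | ih = s≤s ih

∑-mono-≤ : {f g : Fin n → ℚ} → (∀ i → f i ≤ g i) → ∑[ i < n ] f i ≤ ∑[ i < n ] g i
∑-mono-≤ {n = ℕ.zero}  _   = QP.≤-refl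
∑-mono-≤ {n = ℕ.suc n} f≤g = QP.+-mono-≤ (f≤g zero) (∑-mono-≤ (f≤g ∘ suc))

∑-indicator : (j : Fin n) (a : ℚ) → ∑[ i < n ] (if does (j ≟ i) then a else 0ℚ) ≡ a
∑-indicator {ℕ.suc n} zero    a = trans (cong (a +_) (sum-replicate-zero n)) (QP.+-identityʳ a)
∑-indicator {ℕ.suc n} (suc j) a = trans (QP.+-identityˡ _) (∑-indicator j a)

∑-indicator-maybe≤ : (f : A → Fin n) (j : Maybe A) {a : ℚ} → 0ℚ ≤ a →
  ∑[ i < n ] (if maybe (λ x → does (f x ≟ i)) false j then a else 0ℚ) ≤ a
∑-indicator-maybe≤ {n = n} f nothing  0≤a = subst (_≤ _) (sym (sum-replicate-zero n)) 0≤a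
∑-indicator-maybe≤         f (just x) _   = QP.≤-reflexive (∑-indicator (f x) _)

∑-fibres : {m : ℕ} (f : Fin m → Fin n) (h : Fin m → ℚ) →
  ∑[ i < n ] ∑[ e < m ] (if does (f e ≟ i) then h e else 0ℚ) ≡ ∑[ e < m ] h e
∑-fibres f h = trans (∑-comm (λ i e → if does (f e ≟ i) then h e else 0ℚ))
                     (sum-cong-≗ (λ e → ∑-indicator (f e) (h e)))

foldr-filterᵇ-tabulate : (F : A → Bool) (g : A → ℚ) (f : Fin n → A) →
  foldr _+_ 0ℚ (map g (filterᵇ F (tabulate f))) ≡ ∑[ i < n ] (if F (f i) then g (f i) else 0ℚ)
foldr-filterᵇ-tabulate {n = ℕ.zero}  F g f = refl
foldr-filterᵇ-tabulate {n = ℕ.suc n} F g f with F (f zero)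
... | true  = cong (g (f zero) +_) (foldr-filterᵇ-tabulate F g (f ∘ suc))
... | false = trans (foldr-filterᵇ-tabulate F g (f ∘ suc)) (sym (QP.+-identityˡ _))

p≤p+q : (p : ℚ) {q : ℚ} → 0ℚ ≤ q → p ≤ p + q
p≤p+q p 0≤q = QP.≤-trans (QP.≤-reflexive (sym (QP.+-identityʳ p))) (QP.+-monoʳ-≤ p 0≤q)

+-cancel-≤ : {x y z : ℚ} → x + z ≤ z + y → x ≤ y
+-cancel-≤ {x} {y} {z} x+z≤z+y = begin
  x               ≡⟨ solve 2 (λ x z → x := (x :+ z) :+ (:- z)) refl x z ⟩
  (x + z) + - z   ≤⟨ QP.+-monoˡ-≤ (- z) x+z≤z+y ⟩
  (z + y) + - z   ≡⟨ solve 2 (λ y z → (z :+ y) :+ (:- z) := y) refl y z ⟩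
  y               ∎
  where
    open QP.≤-Reasoning
    open import Data.Rational.Solver
    open +-*-Solver

½*-≤ : {x y : ℚ} → x ≤ y + y → ½ * x ≤ y
½*-≤ {x} {y} x≤2y = begin
  ½ * x           ≤⟨ QP.*-monoˡ-≤-nonNeg ½ x≤2y ⟩
  ½ * (y + y)     ≡⟨ solve 1 (λ y → con ½ :* (y :+ y) := y) refl y ⟩
  y               ∎
  where
    open QP.≤-Reasoning
    open import Data.Rational.Solver
    open +-*-Solver

T-if-∧ : (c a b d r : Bool) → T ((if c then a else b ∧ d) ∧ r) → T (((a ∧ r) ∧ c) ∨ ((b ∧ r) ∧ d))
T-if-∧ true  true  _     _     true  _ = tt
T-if-∧ true  true  _     _     false ()
T-if-∧ true  false _     _     _     ()
T-if-∧ false _     false _     _     ()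
T-if-∧ false _     true  false _     ()
T-if-∧ false _     true  true  false ()
T-if-∧ false true  true  true  true  _ = tt
T-if-∧ false false true  true  true  _ = tt

boolFunctions : (n : ℕ) → List (Fin n → Bool)
boolFunctions ℕ.zero    = [ (λ ()) ]
boolFunctions (ℕ.suc n) = map (false Vector.∷_) (boolFunctions n) ++ map (true Vector.∷_) (boolFunctions n)

boolFunctions-complete : (F : Fin n → Bool) → Σ (Fin n → Bool) λ G → G ∈ boolFunctions n × G ≗ F
boolFunctions-complete {ℕ.zero}  F = (λ ()) , here refl , λ ()
boolFunctions-complete {ℕ.suc n} F with boolFunctions-complete (F ∘ suc) | F zero in F₀
... | G , G∈ , G≗F | false =
  false Vector.∷ G , ∈-++⁺ˡ (∈-map⁺ _ G∈) , λ { zero → sym F₀ ; (suc i) → G≗F i }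
... | G , G∈ , G≗F | true =
  true Vector.∷ G , ∈-++⁺ʳ _ (∈-map⁺ _ G∈) , λ { zero → sym F₀ ; (suc i) → G≗F i }

all-⊎? : {P : A ⊎ B → Set} → Dec (∀ a → P (inj₁ a)) → Dec (∀ b → P (inj₂ b)) → Dec (∀ x → P x)
all-⊎? a? b? = map′ (λ (f , g) → [_,_] f g) (λ h → h ∘ inj₁ , h ∘ inj₂) (a? ×-dec b?)

_≤cap?_ : (k : ℕ) (c : Cap) → Dec (k ≤cap c)
k ≤cap? nothing = yes tt
k ≤cap? just c  = k ℕ.≤? c

≤cap-trans : {j k : ℕ} (c : Cap) → j ℕ.≤ k → k ≤cap c → j ≤cap c
≤cap-trans nothing  _   _   = tt
≤cap-trans (just c) j≤k k≤c = ℕP.≤-trans j≤k k≤c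

⊔-≤cap : {j k : ℕ} (c : Cap) → j ≤cap c → k ≤cap c → (j ⊔ k) ≤cap c
⊔-≤cap nothing  _   _   = tt
⊔-≤cap (just c) j≤c k≤c = ℕP.⊔-lub j≤c k≤c

_[_]≔_ : (Fin n → A) → Fin n → A → Fin n → A
(p [ u ]≔ x) u′ = if does (u′ ≟ u) then x else p u′

[]≔-same : (p : Fin n → A) (u : Fin n) {x : A} → p u ≡ x → p [ u ]≔ x ≗ p
[]≔-same p u pu≡x u′ with u′ ≟ u
... | yes refl = sym pu≡x
... | no _     = refl

module _ (I : Instance) where
  open Instance I

  gain : (Fin nL → ℚ) → (Fin m → Bool) → Fin m → ℚ
  gain q F e = if F e then q (left e) else 0ℚ

  gain-nonNeg : {q : Fin nL → ℚ} → (∀ u → 0ℚ ≤ q u) → (F : Fin m → Bool) (e : Fin m) → 0ℚ ≤ gain q F e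
  gain-nonNeg q≥0 F e with F e
  ... | true  = q≥0 (left e)
  ... | false = QP.≤-refl

  revenue≡∑gain : (q : Fin nL → ℚ) (F : Fin m → Bool) → revenue I q F ≡ ∑[ e < m ] gain q F e
  revenue≡∑gain q F = trans (foldr-filterᵇ-tabulate F (λ e → q (left e) + 0ℚ) id)
    (sum-cong-≗ λ e → cong (λ x → if F e then x else 0ℚ) (QP.+-identityʳ (q (left e))))

  revenue-cong : {q q′ : Fin nL → ℚ} {F F′ : Fin m → Bool} → q ≗ q′ → F ≗ F′ → revenue I q F ≡ revenue I q′ F′
  revenue-cong {q} {q′} {F} {F′} q≗q′ F≗F′ = begin
    revenue I q F            ≡⟨ revenue≡∑gain q F ⟩
    ∑[ e < m ] gain q F e    ≡⟨ sum-cong-≗ (λ e → cong₂ (λ b x → if b then x else 0ℚ) (F≗F′ e) (q≗q′ (left e))) ⟩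
    ∑[ e < m ] gain q′ F′ e  ≡⟨ revenue≡∑gain q′ F′ ⟨
    revenue I q′ F′          ∎
    where open ≡-Reasoning

  T-incident-inj₁ : ∀ e u → T (incident I e (inj₁ u)) → left e ≡ u
  T-incident-inj₁ e u t with Equivalence.to (T-∨ {⌊ _≟V_ I (endL I e) (inj₁ u) ⌋}) t
  ... | inj₁ e∼u = inj₁-injective (toWitness e∼u)

  T-incident-inj₂ : ∀ e v → T (incident I e (inj₂ v)) → right e ≡ v
  T-incident-inj₂ e v t = inj₂-injective (toWitness t)

  degF≡count : (F : Fin m → Bool) (w : Vertex I) → degF I F w ≡ count (λ e → F e ∧ incident I e w) (allFin m)
  degF≡count F w = length-filterᵇ (λ e → F e ∧ incident I e w) (allFin m)

  degF-mono : {F G : Fin m → Bool} (w : Vertex I) → (∀ e → T (incident I e w) → T (F e) → T (G e)) →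
    degF I F w ℕ.≤ degF I G w
  degF-mono {F} {G} w F⇒G = ℕP.≤-trans (ℕP.≤-reflexive (degF≡count F w))
    (ℕP.≤-trans (count-mono restricted (allFin m)) (ℕP.≤-reflexive (sym (degF≡count G w))))
    where
      restricted : ∀ e → T (F e ∧ incident I e w) → T (G e ∧ incident I e w)
      restricted e t with Equivalence.to T-∧ t
      ... | Fe , e∼w = Equivalence.from T-∧ (F⇒G e e∼w Fe , e∼w)

  degF-inj₁-mono : {F G : Fin m → Bool} (u : Fin nL) → (∀ e → left e ≡ u → T (F e) → T (G e)) →
    degF I F (inj₁ u) ℕ.≤ degF I G (inj₁ u)
  degF-inj₁-mono u F⇒G = degF-mono (inj₁ u) (λ e → F⇒G e ∘ T-incident-inj₁ e u)

  Feasible-cong : {q q′ : Fin nL → ℚ} {F F′ : Fin m → Bool} → q ≗ q′ → F ≗ F′ → Feasible I q F → Feasible I q′ F′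
  Feasible-cong {q} {q′} {F} {F′} q≗q′ F≗F′ (within-budget , within-capacity) =
    (λ e t → subst (λ x → x + 0ℚ ≤ budget e) (q≗q′ (left e)) (within-budget e (subst T (sym (F≗F′ e)) t))) ,
    (λ w → subst (_≤cap μ I w) (same-degree w) (within-capacity w))
    where
      same-degree : ∀ w → degF I F w ≡ degF I F′ w
      same-degree w = trans (degF≡count F w) (trans
        (count-cong _ _ (allFin m) (λ {e} _ → cong (_∧ incident I e w) (F≗F′ e))) (sym (degF≡count F′ w)))

  feasible? : (q : Fin nL → ℚ) (F : Fin m → Bool) → Dec (Feasible I q F)
  feasible? q F =
    all? (λ e → T? (F e) →-dec q (left e) + 0ℚ QP.≤? budget e) ×-dec
    all-⊎? (all? λ u → degF I F (inj₁ u) ≤cap? μL u) (all? λ v → degF I F (inj₂ v) ≤cap? μR v)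

  value-exists : {q : Fin nL → ℚ} {F : Fin m → Bool} → Feasible I q F → ∃ (IsVal I q)
  value-exists {q} {F} F-feasible = revenue I q best , (best , best-feasible , refl) , maximal
    where
      candidates : List (Fin m → Bool)
      candidates = filter (feasible? q) (boolFunctions m)

      best : Fin m → Bool
      best = argmax (revenue I q) F candidates

      best-feasible : Feasible I q best
      best-feasible = argmax-all (revenue I q) F-feasible (all-filter (feasible? q) (boolFunctions m))

      maximal : ∀ H → Feasible I q H → revenue I q H ≤ revenue I q best
      maximal H H-feasible with boolFunctions-complete H
      ... | G , G∈ , G≗H =
        subst (_≤ revenue I q best) (revenue-cong {q = q} (λ _ → refl) G≗H)
          (All.lookup (f[xs]≤f[argmax] {f = revenue I q} F candidates)
            (∈-filter⁺ (feasible? q) G∈ (Feasible-cong {q = q} (λ _ → refl) (sym ∘ G≗H) H-feasible)))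

  IsPricing-nonNeg : {q : Fin nL → ℚ} → IsPricing I q → ∀ u → 0ℚ ≤ q u
  IsPricing-nonNeg q-pricing u with q-pricing u
  ... | e , _ , qu≡be = subst (0ℚ ≤_) (sym qu≡be) (budget≥0 e)

  IsPricing-[]≔ : {p p′ : Fin nL → ℚ} → IsPricing I p → IsPricing I p′ → ∀ u → IsPricing I (p [ u ]≔ p′ u)
  IsPricing-[]≔ p-pricing p′-pricing u u′ with u′ ≟ u
  ... | yes refl = p′-pricing u′
  ... | no _     = p-pricing u′

  HW-[]≔ : (p : Fin nL → ℚ) (u : Fin nL) {x : ℚ} → p u ≢ x → HW I p (p [ u ]≔ x) ≡ 1
  HW-[]≔ p u {x} pu≢x =
    length-filter-unique (λ u′ → ¬? (p u′ QP.≟ (p [ u ]≔ x) u′)) (allFin⁺ nL) (∈-allFin u) differs-at-u only-u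
    where
      differs-at-u : p u ≢ (p [ u ]≔ x) u
      differs-at-u rewrite dec-true (u ≟ u) refl = pu≢x

      only-u : ∀ {u′} → p u′ ≢ (p [ u ]≔ x) u′ → u′ ≡ u
      only-u {u′} differs with u′ ≟ u
      ... | yes u′≡u = u′≡u
      ... | no _     = ⊥-elim (differs refl)

  edgesAt : (Fin m → Bool) → Fin nR → List (Fin m)
  edgesAt F v = filterᵇ (λ e → F e ∧ incident I e (inj₂ v)) (allFin m)

  ∈-edgesAt⇒right : (F : Fin m → Bool) (v : Fin nR) {f : Fin m} → f ∈ edgesAt F v → right f ≡ v
  ∈-edgesAt⇒right F v {f} f∈ = T-incident-inj₂ f v
    (proj₂ (Equivalence.to (T-∧ {F f}) (proj₂ (∈-filter⁻ (λ e → T? (F e ∧ incident I e (inj₂ v))) {xs = allFin m} f∈))))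

  module Exchange (pstar p : Fin nL → ℚ) (Fs Fp : Fin m → Bool) where

    partner : Fin m → Maybe (Fin m)
    partner f = partnerIn _≟_ f (edgesAt Fp (right f)) (edgesAt Fs (right f))

    displaced : Fin nL → Fin m → Bool
    displaced u f = maybe (λ e → does (left e ≟ u)) false (partner f)

    exchanged : Fin nL → Fin m → Bool
    exchanged u e = if does (left e ≟ u) then Fs e else Fp e ∧ not (displaced u e)

    deviation : Fin nL → Fin nL → ℚ
    deviation u = p [ u ]≔ pstar u

    exchanged-degreeʳ : ∀ u v → degF I (exchanged u) (inj₂ v) ℕ.≤ degF I Fp (inj₂ v) ⊔ degF I Fs (inj₂ v)
    exchanged-degreeʳ u v = begin
      degF I (exchanged u) (inj₂ v)
        ≡⟨ degF≡count (exchanged u) (inj₂ v) ⟩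
      count (λ e → exchanged u e ∧ at-v e) es
        ≤⟨ count-mono (λ e → T-if-∧ (at-u e) (Fs e) (Fp e) (not (displaced u e)) (at-v e)) es ⟩
      count (λ e → ((Fs e ∧ at-v e) ∧ at-u e) ∨ ((Fp e ∧ at-v e) ∧ not (displaced u e))) es
        ≤⟨ count-∨ _ _ es ⟩
      count (λ e → (Fs e ∧ at-v e) ∧ at-u e) es ℕ.+ count (λ e → (Fp e ∧ at-v e) ∧ not (displaced u e)) es
        ≡⟨ cong₂ ℕ._+_ (count-filterᵇ at-u _ es) (count-filterᵇ (not ∘ displaced u) _ es) ⟨
      count at-u (edgesAt Fs v) ℕ.+ count (not ∘ displaced u) (edgesAt Fp v)
        ≡⟨ ℕP.+-comm (count at-u (edgesAt Fs v)) _ ⟩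
      count (not ∘ displaced u) (edgesAt Fp v) ℕ.+ count at-u (edgesAt Fs v)
        ≡⟨ cong (ℕ._+ count at-u (edgesAt Fs v)) (count-cong _ _ (edgesAt Fp v) partner-at-v) ⟩
      count (λ f → not (maybe at-u false (partnerIn _≟_ f (edgesAt Fp v) (edgesAt Fs v)))) (edgesAt Fp v)
        ℕ.+ count at-u (edgesAt Fs v)
        ≤⟨ count-unpartnered _≟_ at-u (edgesAt Fp v) (edgesAt Fs v) (Unique-filter⁺ _ (allFin⁺ m)) ⟩
      length (edgesAt Fp v) ⊔ length (edgesAt Fs v) ∎
      where
        open ℕP.≤-Reasoning
        es = allFin m
        at-u : Fin m → Bool
        at-u e = does (left e ≟ u)
        at-v : Fin m → Bool
        at-v e = incident I e (inj₂ v)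
        partner-at-v : ∀ {f} → f ∈ edgesAt Fp v →
          not (displaced u f) ≡ not (maybe at-u false (partnerIn _≟_ f (edgesAt Fp v) (edgesAt Fs v)))
        partner-at-v {f} f∈ = cong (λ w → not (maybe at-u false (partnerIn _≟_ f (edgesAt Fp w) (edgesAt Fs w))))
          (∈-edgesAt⇒right Fp v f∈)

    exchanged-feasible : Feasible I pstar Fs → Feasible I p Fp → ∀ u → Feasible I (deviation u) (exchanged u)
    exchanged-feasible (Fs-budget , Fs-capacity) (Fp-budget , Fp-capacity) u =
      within-budget , λ { (inj₁ u′) → degreeˡ u′ ; (inj₂ v) → degreeʳ v }
      where
        within-budget : ∀ e → T (exchanged u e) → deviation u (left e) + 0ℚ ≤ budget e
        within-budget e with left e ≟ u
        ... | yes refl = Fs-budget e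
        ... | no _     = Fp-budget e ∘ proj₁ ∘ Equivalence.to T-∧

        degreeˡ : ∀ u′ → degF I (exchanged u) (inj₁ u′) ≤cap μL u′
        degreeˡ u′ with u′ ≟ u
        ... | yes refl = ≤cap-trans (μL u′) (degF-inj₁-mono u′ at-u) (Fs-capacity (inj₁ u′))
          where
            at-u : ∀ e → left e ≡ u′ → T (exchanged u′ e) → T (Fs e)
            at-u e left≡u′ rewrite left≡u′ | dec-true (u′ ≟ u′) refl = λ Fs-e → Fs-e
        ... | no u′≢u = ≤cap-trans (μL u′) (degF-inj₁-mono u′ off-u) (Fp-capacity (inj₁ u′))
          where
            off-u : ∀ e → left e ≡ u′ → T (exchanged u e) → T (Fp e)
            off-u e refl rewrite dec-false (left e ≟ u) u′≢u = proj₁ ∘ Equivalence.to T-∧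

        degreeʳ : ∀ v → degF I (exchanged u) (inj₂ v) ≤cap μR v
        degreeʳ v = ≤cap-trans (μR v) (exchanged-degreeʳ u v)
          (⊔-≤cap (μR v) (Fp-capacity (inj₂ v)) (Fs-capacity (inj₂ v)))

    gainAt : (Fin nL → ℚ) → (Fin m → Bool) → Fin nL → Fin m → ℚ
    gainAt q F u e = if does (left e ≟ u) then gain q F e else 0ℚ

    lostGain : Fin nL → Fin m → ℚ
    lostGain u e = if displaced u e then gain p Fp e else 0ℚ

    gain-exchanged : (∀ u → 0ℚ ≤ p u) → ∀ u e →
      gainAt pstar Fs u e + gain p Fp e ≤ gain (deviation u) (exchanged u) e + (gainAt p Fp u e + lostGain u e)
    gain-exchanged p≥0 u e with left e ≟ u
    ... | yes refl = QP.+-monoʳ-≤ (gain pstar Fs e) (p≤p+q (gain p Fp e) (lostGain-nonNeg (displaced (left e) e)))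
      where
        lostGain-nonNeg : ∀ b → 0ℚ ≤ (if b then gain p Fp e else 0ℚ)
        lostGain-nonNeg true  = gain-nonNeg p≥0 Fp e
        lostGain-nonNeg false = QP.≤-refl
    ... | no _ with Fp e | displaced u e
    ...   | true  | true  = QP.≤-reflexive (cong (0ℚ +_) (sym (QP.+-identityˡ (p (left e)))))
    ...   | true  | false = QP.≤-reflexive (QP.+-comm 0ℚ (p (left e)))
    ...   | false | true  = QP.≤-refl
    ...   | false | false = QP.≤-refl

    gainAt-bound : (∀ u → 0ℚ ≤ p u) → ∀ u →
      revenue I (deviation u) (exchanged u) ≤ revenue I p Fp →
      ∑[ e < m ] gainAt pstar Fs u e ≤ ∑[ e < m ] gainAt p Fp u e + ∑[ e < m ] lostGain u e
    gainAt-bound p≥0 u unprofitable = +-cancel-≤ (begin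
      ∑[ e < m ] gainAt pstar Fs u e + ∑[ e < m ] gain p Fp e
        ≡⟨ ∑-distrib-+ (gainAt pstar Fs u) (gain p Fp) ⟨
      ∑[ e < m ] (gainAt pstar Fs u e + gain p Fp e)
        ≤⟨ ∑-mono-≤ (gain-exchanged p≥0 u) ⟩
      ∑[ e < m ] (gain (deviation u) (exchanged u) e + (gainAt p Fp u e + lostGain u e))
        ≡⟨ ∑-distrib-+ (gain (deviation u) (exchanged u)) _ ⟩
      ∑[ e < m ] gain (deviation u) (exchanged u) e + ∑[ e < m ] (gainAt p Fp u e + lostGain u e)
        ≡⟨ cong₂ _+_ (revenue≡∑gain (deviation u) (exchanged u)) (sym (∑-distrib-+ (gainAt p Fp u) (lostGain u))) ⟨
      revenue I (deviation u) (exchanged u) + kept+lost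
        ≤⟨ QP.+-monoˡ-≤ kept+lost unprofitable ⟩
      revenue I p Fp + kept+lost
        ≡⟨ cong (_+ kept+lost) (revenue≡∑gain p Fp) ⟩
      ∑[ e < m ] gain p Fp e + kept+lost ∎)
      where
        open QP.≤-Reasoning
        kept+lost : ℚ
        kept+lost = ∑[ e < m ] gainAt p Fp u e + ∑[ e < m ] lostGain u e

    exchange-bound : (∀ u → 0ℚ ≤ p u) →
      (∀ u → revenue I (deviation u) (exchanged u) ≤ revenue I p Fp) →
      revenue I pstar Fs ≤ revenue I p Fp + revenue I p Fp
    exchange-bound p≥0 unprofitable = begin
      revenue I pstar Fs
        ≡⟨ revenue≡∑gain pstar Fs ⟩
      ∑[ e < m ] gain pstar Fs e
        ≡⟨ ∑-fibres left (gain pstar Fs) ⟨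
      ∑[ u < nL ] ∑[ e < m ] gainAt pstar Fs u e
        ≤⟨ ∑-mono-≤ (λ u → gainAt-bound p≥0 u (unprofitable u)) ⟩
      ∑[ u < nL ] (∑[ e < m ] gainAt p Fp u e + ∑[ e < m ] lostGain u e)
        ≡⟨ ∑-distrib-+ (λ u → ∑[ e < m ] gainAt p Fp u e) _ ⟩
      ∑[ u < nL ] ∑[ e < m ] gainAt p Fp u e + ∑[ u < nL ] ∑[ e < m ] lostGain u e
        ≤⟨ QP.+-mono-≤ (QP.≤-reflexive (∑-fibres left (gain p Fp))) lost≤ ⟩
      ∑[ e < m ] gain p Fp e + ∑[ e < m ] gain p Fp e
        ≡⟨ cong₂ _+_ (revenue≡∑gain p Fp) (revenue≡∑gain p Fp) ⟨
      revenue I p Fp + revenue I p Fp ∎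
      where
        open QP.≤-Reasoning
        lost≤ : ∑[ u < nL ] ∑[ e < m ] lostGain u e ≤ ∑[ e < m ] gain p Fp e
        lost≤ = QP.≤-trans (QP.≤-reflexive (∑-comm lostGain))
          (∑-mono-≤ λ e → ∑-indicator-maybe≤ left (partner e) (gain-nonNeg p≥0 Fp e))

    deviation-unprofitable : IsPricing I pstar → IsPricing I p → Feasible I pstar Fs → Feasible I p Fp →
      {v : ℚ} → IsVal I p v →
      (∀ q w → IsPricing I q → HW I p q ≡ 1 → IsVal I q w → w ≤ v) →
      ∀ u → revenue I (deviation u) (exchanged u) ≤ v
    deviation-unprofitable pstar-pricing p-pricing Fs-feasible Fp-feasible {v} (_ , p-maximal) locally-optimal u =
      by-cases (pstar u QP.≟ p u)
      where
        feasible : Feasible I (deviation u) (exchanged u)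
        feasible = exchanged-feasible Fs-feasible Fp-feasible u

        by-cases : Dec (pstar u ≡ p u) → revenue I (deviation u) (exchanged u) ≤ v
        by-cases (yes pstar-u≡p-u) =
          subst (_≤ v) (sym (revenue-cong {q = deviation u} deviation≗p λ _ → refl))
            (p-maximal (exchanged u) (Feasible-cong {q = deviation u} deviation≗p (λ _ → refl) feasible))
          where
            deviation≗p : deviation u ≗ p
            deviation≗p = []≔-same p u (sym pstar-u≡p-u)
        by-cases (no pstar-u≢p-u) =
          let (w , w-value) = value-exists {q = deviation u} feasible
          in QP.≤-trans (proj₂ w-value (exchanged u) feasible)
               (locally-optimal (deviation u) w (IsPricing-[]≔ p-pricing pstar-pricing u)
                 (HW-[]≔ p u (pstar-u≢p-u ∘ sym)) w-value)

theorem9 : (I : Instance) →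
    (pstar p : Fin (Instance.nL I) → ℚ) →
    IsPricing I pstar →
    IsPricing I p →
    (vstar v : ℚ) → IsVal I pstar vstar → IsVal I p v →
    -- p* is optimal
    (∀ (q : Fin (Instance.nL I) → ℚ) (w : ℚ) → IsPricing I q → IsVal I q w → w ≤ vstar) →
    -- p is locally optimal
    (∀ (q : Fin (Instance.nL I) → ℚ) (w : ℚ) → IsPricing I q → HW I p q ≡ 1 → IsVal I q w → w ≤ v) →
    ½ * vstar ≤ v
theorem9 I pstar p pstar-pricing p-pricing _ _
  ((Fs , Fs-feasible , refl) , _) p-value@((Fp , Fp-feasible , refl) , _) _ locally-optimal =
  ½*-≤ (exchange-bound (IsPricing-nonNeg I p-pricing)
    (deviation-unprofitable pstar-pricing p-pricing Fs-feasible Fp-feasible p-value locally-optimal))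
  where open Exchange I pstar p Fs Fp
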